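{- Let $(\mathbb{C},P)$ be an elementary existential doctrine with singletons. Then for every object $A$ of $\mathbb{C}$ there exists a morphism $\eta_A:A\to S_A$ which is internally bijective.
   Context: A doctrine is a pair $(\mathbb{C},P)$ with $\mathbb{C}$ a category with finite products and $P:\mathbb{C}^{op}\to\mathbf{ISL}$ a functor into inf-semilattices; write $f^*=P(f)$, $\wedge$ for meets, $\top_A$ for the top of $P(A)$. It is elementary existential if each $f^*$ has a left adjoint $\exists_f$ satisfying Beck–Chevalley for pullbacks and Frobenius reciprocity $\exists_f(\alpha\wedge f^*\beta)=\exists_f\alpha\wedge\beta$. Equality on $A$: $\delta_A=\exists_{\Delta_A}\top_A\in P(A\times A)$. A comprehension of $\alpha\in P(A)$ is a morphism $\lfloor\alpha\rfloor:X\to A$ with $\top_X\le\lfloor\alpha\rfloor^*\alpha$ such that every $f:Y\to A$ with $\top_Y\le f^*\alpha$ factors uniquely as $f=\lfloor\alpha\rfloor\circ h$; a morphism $f:X\to Y$ has an image if $\exists_f\top_X$ has a comprehension. The doctrine has power objects if for each $X$ there are an object $\mathbb{P}(X)$ and $\in_X\in P(X\times\mathbb{P}(X))$ such that for each $\gamma\in P(X\times Y)$ there is a unique $\{\gamma\}:Y\to\mathbb{P}(X)$ with $\gamma=(\mathrm{id}_X\times\{\gamma\})^*\in_X$. A formula $F\in P(Y\times A)$ is a functional relation from $Y$ to $A$ if $F(y,a)\wedge F(y,a')\le\delta_A(a,a')$ and $\exists a{:}A.\,F(y,a)=\top_Y$ (internal-language notation). A morphism $f:A\to B$ is internally injective if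 $\delta_A=(f\times f)^*\delta_B$, internally surjective if $\exists_f\top_A=\top_B$, internally bijective if both. The doctrine has singletons if (i) it has power objects; (ii) for every $A$ the morphism $\{\delta_A\}:A\to\mathbb{P}(A)$ has an image and is internally injective; (iii) for every $g:Y\to\mathbb{P}(A)$, the formula $(\mathrm{id}_A\times g)^*\in_A$ (i.e. $a\in_A g(y)$), read as a relation from $Y$ to $A$, is a functional relation from $Y$ to $A$ if and only if $g^*(\exists_{\{\delta_A\}}\top_A)=\top_Y$. Write $\sigma_A=\exists_{\{\delta_A\}}\top_A\in P(\mathbb{P}(A))$ and $\lfloor\sigma_A\rfloor:S_A\to\mathbb{P}(A)$ for its comprehension. -}

module Defs where

open import Level using (Level; _⊔_) renaming (suc to lsuc)
open import Relation.Binary.PropositionalEquality using (_≡_)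
open import Data.Product using (Σ; _×_; _,_; proj₁; proj₂; Σ-syntax)

-- Categories (hom-equality is propositional equality)

record Category (o h : Level) : Set (lsuc (o ⊔ h)) where
  infixr 9 _∘_
  field
    Obj : Set o
    Hom : Obj → Obj → Set h
    id  : ∀ {A} → Hom A A
    _∘_ : ∀ {A B C} → Hom B C → Hom A B → Hom A C
    identityˡ : ∀ {A B} (f : Hom A B) → id ∘ f ≡ f
    identityʳ : ∀ {A B} (f : Hom A B) → f ∘ id ≡ f
    assoc : ∀ {A B C D} (f : Hom A B) (g : Hom B C) (k : Hom C D) →
            (k ∘ g) ∘ f ≡ k ∘ (g ∘ f)

record FinProducts {o h : Level} (C : Category o h) : Set (o ⊔ h) where
  open Category C
  field
    𝟙 : Obj
    ! : ∀ {A} → Hom A 𝟙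
    !-unique : ∀ {A} (f : Hom A 𝟙) → f ≡ !
    _⊗_ : Obj → Obj → Obj
    π₁ : ∀ {A B} → Hom (A ⊗ B) A
    π₂ : ∀ {A B} → Hom (A ⊗ B) B
    ⟨_,_⟩ : ∀ {X A B} → Hom X A → Hom X B → Hom X (A ⊗ B)
    π₁-⟨⟩ : ∀ {X A B} (f : Hom X A) (g : Hom X B) → π₁ ∘ ⟨ f , g ⟩ ≡ f
    π₂-⟨⟩ : ∀ {X A B} (f : Hom X A) (g : Hom X B) → π₂ ∘ ⟨ f , g ⟩ ≡ g
    ⟨⟩-unique : ∀ {X A B} (f : Hom X A) (g : Hom X B) (k : Hom X (A ⊗ B)) →
                π₁ ∘ k ≡ f → π₂ ∘ k ≡ g → k ≡ ⟨ f , g ⟩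

  Δ : ∀ {A} → Hom A (A ⊗ A)
  Δ = ⟨ id , id ⟩

  _×ₘ_ : ∀ {A B A' B'} → Hom A A' → Hom B B' → Hom (A ⊗ B) (A' ⊗ B')
  f ×ₘ g = ⟨ f ∘ π₁ , g ∘ π₂ ⟩

  swap : ∀ {A B} → Hom (A ⊗ B) (B ⊗ A)
  swap = ⟨ π₂ , π₁ ⟩

-- Pullback squares
--      A' --g'--> A
--      |f'        |f
--      v          v
--      B' --g---> B
module _ {o h : Level} (C : Category o h) where
  open Category C

  IsPullback : ∀ {A' A B' B} → Hom A' A → Hom A' B' → Hom A B → Hom B' B → Set (o ⊔ h)
  IsPullback {A'} {A} {B'} {B} g' f' f g =
    (f ∘ g' ≡ g ∘ f') ×
    (∀ {X} (u : Hom X A) (v : Hom X B') → f ∘ u ≡ g ∘ v →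
       Σ[ k ∈ Hom X A' ] ((g' ∘ k ≡ u × f' ∘ k ≡ v) ×
         (∀ (k' : Hom X A') → g' ∘ k' ≡ u → f' ∘ k' ≡ v → k' ≡ k)))

record Doctrine {o h : Level} (C : Category o h) (Pr : FinProducts C) (p : Level)
       : Set (o ⊔ h ⊔ lsuc p) where
  open Category C
  infixr 7 _∧_
  infix 4 _≤_
  field
    P : Obj → Set p
    _≤_ : ∀ {A} → P A → P A → Set p
    ≤-refl : ∀ {A} (α : P A) → α ≤ α
    ≤-trans : ∀ {A} {α β γ : P A} → α ≤ β → β ≤ γ → α ≤ γ
    ≤-antisym : ∀ {A} {α β : P A} → α ≤ β → β ≤ α → α ≡ β
    _∧_ : ∀ {A} → P A → P A → P A
    ∧-lb₁ : ∀ {A} (α β : P A) → α ∧ β ≤ α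
    ∧-lb₂ : ∀ {A} (α β : P A) → α ∧ β ≤ β
    ∧-glb : ∀ {A} {α β γ : P A} → γ ≤ α → γ ≤ β → γ ≤ α ∧ β
    ⊤ : ∀ A → P A
    ⊤-max : ∀ {A} (α : P A) → α ≤ ⊤ A
    _* : ∀ {A B} → Hom A B → P B → P A
    *-∧ : ∀ {A B} (f : Hom A B) (α β : P B) → (f *) (α ∧ β) ≡ (f *) α ∧ (f *) β
    *-⊤ : ∀ {A B} (f : Hom A B) → (f *) (⊤ B) ≡ ⊤ A
    *-id : ∀ {A} (α : P A) → (id *) α ≡ α
    *-∘ : ∀ {A B D} (f : Hom A B) (g : Hom B D) (α : P D) →
          ((g ∘ f) *) α ≡ (f *) ((g *) α)

record Existential {o h p : Level} {C : Category o h} {Pr : FinProducts C}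
       (D : Doctrine C Pr p) : Set (o ⊔ h ⊔ p) where
  open Category C
  open Doctrine D
  field
    ∃ : ∀ {A B} → Hom A B → P A → P B
    ∃⊣* : ∀ {A B} (f : Hom A B) (α : P A) (β : P B) →
          (∃ f α ≤ β → α ≤ (f *) β) × (α ≤ (f *) β → ∃ f α ≤ β)
    beck-chevalley : ∀ {A' A B' B} (g' : Hom A' A) (f' : Hom A' B') (f : Hom A B) (g : Hom B' B) →
          IsPullback C g' f' f g → (α : P A) → ∃ f' ((g' *) α) ≡ (g *) (∃ f α)
    frobenius : ∀ {A B} (f : Hom A B) (α : P A) (β : P B) →
          ∃ f (α ∧ (f *) β) ≡ ∃ f α ∧ β

module Theory {o h p : Level} {C : Category o h} {Pr : FinProducts C}
              {D : Doctrine C Pr p} (E : Existential D) where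
  open Category C
  open FinProducts Pr
  open Doctrine D
  open Existential E

  δ : ∀ A → P (A ⊗ A)
  δ A = ∃ (Δ {A}) (⊤ A)

  record Comprehension {A : Obj} (α : P A) : Set (o ⊔ h ⊔ p) where
    field
      dom : Obj
      ⌊_⌋ : Hom dom A
      ⌊⌋-sat : ⊤ dom ≤ (⌊_⌋ *) α
      factor : ∀ {Y} (f : Hom Y A) → ⊤ Y ≤ (f *) α →
               Σ[ k ∈ Hom Y dom ] ((f ≡ ⌊_⌋ ∘ k) × (∀ (k' : Hom Y dom) → f ≡ ⌊_⌋ ∘ k' → k' ≡ k))

  HasImage : ∀ {X Y} → Hom X Y → Set (o ⊔ h ⊔ p)
  HasImage {X} f = Comprehension (∃ f (⊤ X))

  InternallyInjective : ∀ {A B} → Hom A B → Set p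
  InternallyInjective {A} {B} f = δ A ≡ ((f ×ₘ f) *) (δ B)

  InternallySurjective : ∀ {A B} → Hom A B → Set p
  InternallySurjective {A} {B} f = ∃ f (⊤ A) ≡ ⊤ B

  InternallyBijective : ∀ {A B} → Hom A B → Set p
  InternallyBijective f = InternallyInjective f × InternallySurjective f

  -- functional relation F ∈ P(Y × A) from Y to A:
  --   F(y,a) ∧ F(y,a') ≤ δ_A(a,a')   (in context Y × (A × A))
  --   ∃a:A. F(y,a) = ⊤_Y
  FunctionalRelation : ∀ {Y A} → P (Y ⊗ A) → Set p
  FunctionalRelation {Y} {A} F =
    ((⟨ π₁ , π₁ ∘ π₂ ⟩ *) F ∧ (⟨ π₁ , π₂ ∘ π₂ ⟩ *) F
       ≤ ((π₂ {Y} {A ⊗ A}) *) (δ A))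
    × (∃ (π₁ {Y} {A}) F ≡ ⊤ Y)

  record PowerObjects : Set (o ⊔ h ⊔ p) where
    field
      ℙ : Obj → Obj
      ∈ : ∀ X → P (X ⊗ ℙ X)
      ｛_｝ : ∀ {X Y} → P (X ⊗ Y) → Hom Y (ℙ X)
      ｛｝-spec : ∀ {X Y} (γ : P (X ⊗ Y)) → γ ≡ ((id ×ₘ ｛ γ ｝) *) (∈ X)
      ｛｝-unique : ∀ {X Y} (γ : P (X ⊗ Y)) (k : Hom Y (ℙ X)) →
                  γ ≡ ((id ×ₘ k) *) (∈ X) → k ≡ ｛ γ ｝

    sing : ∀ A → Hom A (ℙ A)
    sing A = ｛ δ A ｝

    σ : ∀ A → P (ℙ A)
    σ A = ∃ (sing A) (⊤ A)

  record Singletons : Set (o ⊔ h ⊔ p) where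
    field
      powers : PowerObjects
    open PowerObjects powers
    field
      sing-image : ∀ A → HasImage (sing A)
      sing-injective : ∀ A → InternallyInjective (sing A)
      sing-functional : ∀ {Y A} (g : Hom Y (ℙ A)) →
        (FunctionalRelation ((swap *) (((id ×ₘ g) *) (∈ A))) → (g *) (σ A) ≡ ⊤ Y) ×
        ((g *) (σ A) ≡ ⊤ Y → FunctionalRelation ((swap *) (((id ×ₘ g) *) (∈ A))))

-- The singleton map {δ_A} : A → ℙ(A) factors through the comprehension of its image
-- σ_A as η_A. Any morphism factors through its image by an internally surjective map,
-- because comprehensions are monic and ∃ along a monic is a section of reindexing
-- (Beck–Chevalley on its kernel pair). Internal injectivity of {δ_A} passes to η_A,
-- since every morphism preserves equality.
module Submission where

open import Defs
open import Data.Product using (Σ; _×_; Σ-syntax; _,_; proj₁; proj₂)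
open import Level using (Level)
open import Relation.Binary.PropositionalEquality

module ElementaryExistential {o h p : Level} {C : Category o h} {Pr : FinProducts C}
                             {D : Doctrine C Pr p} (E : Existential D) where
  open Category C
  open FinProducts Pr
  open Doctrine D
  open Existential E
  open Theory E
  open ≡-Reasoning

  ⟨⟩-∘ : ∀ {X Y A B} (f : Hom Y A) (g : Hom Y B) (k : Hom X Y) →
         ⟨ f , g ⟩ ∘ k ≡ ⟨ f ∘ k , g ∘ k ⟩
  ⟨⟩-∘ f g k = ⟨⟩-unique _ _ _
    (trans (sym (assoc k ⟨ f , g ⟩ π₁)) (cong (_∘ k) (π₁-⟨⟩ f g)))
    (trans (sym (assoc k ⟨ f , g ⟩ π₂)) (cong (_∘ k) (π₂-⟨⟩ f g)))

  ×ₘ-Δ : ∀ {A B} (f : Hom A B) → (f ×ₘ f) ∘ Δ ≡ Δ ∘ f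
  ×ₘ-Δ f = begin
    ⟨ f ∘ π₁ , f ∘ π₂ ⟩ ∘ Δ           ≡⟨ ⟨⟩-∘ _ _ _ ⟩
    ⟨ (f ∘ π₁) ∘ Δ , (f ∘ π₂) ∘ Δ ⟩   ≡⟨ cong₂ ⟨_,_⟩ (after (π₁-⟨⟩ id id)) (after (π₂-⟨⟩ id id)) ⟩
    ⟨ id ∘ f , id ∘ f ⟩               ≡⟨ sym (⟨⟩-∘ _ _ _) ⟩
    Δ ∘ f                             ∎
    where
      after : ∀ {π} → π ∘ Δ ≡ id → (f ∘ π) ∘ Δ ≡ id ∘ f
      after {π} π∘Δ≡id = begin
        (f ∘ π) ∘ Δ  ≡⟨ assoc _ _ _ ⟩
        f ∘ (π ∘ Δ)  ≡⟨ cong (f ∘_) π∘Δ≡id ⟩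
        f ∘ id       ≡⟨ identityʳ f ⟩
        f            ≡⟨ sym (identityˡ f) ⟩
        id ∘ f       ∎

  ×ₘ-∘ : ∀ {A B B'} (g : Hom B B') (f : Hom A B) → (g ×ₘ g) ∘ (f ×ₘ f) ≡ (g ∘ f) ×ₘ (g ∘ f)
  ×ₘ-∘ {A} g f = trans (⟨⟩-∘ _ _ _) (cong₂ ⟨_,_⟩ (after (π₁-⟨⟩ _ _)) (after (π₂-⟨⟩ _ _)))
    where
      after : ∀ {π} {k : Hom (A ⊗ A) A} → π ∘ (f ×ₘ f) ≡ f ∘ k → (g ∘ π) ∘ (f ×ₘ f) ≡ (g ∘ f) ∘ k
      after π-f = trans (assoc _ _ _) (trans (cong (g ∘_) π-f) (sym (assoc _ _ _)))

  *-mono : ∀ {A B} (f : Hom A B) {α β : P B} → α ≤ β → (f *) α ≤ (f *) β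
  *-mono f {α} {β} α≤β = subst (_≤ (f *) β) (sym f*α≡f*α∧f*β) (∧-lb₂ _ _)
    where
      f*α≡f*α∧f*β : (f *) α ≡ (f *) α ∧ (f *) β
      f*α≡f*α∧f*β = trans (cong (f *) (≤-antisym (∧-glb (≤-refl α) α≤β) (∧-lb₁ α β))) (*-∧ f α β)

  ≤-reflexive : ∀ {A} {α β : P A} → α ≡ β → α ≤ β
  ≤-reflexive refl = ≤-refl _

  ⊤≤⇒≡⊤ : ∀ {A} {α : P A} → ⊤ A ≤ α → α ≡ ⊤ A
  ⊤≤⇒≡⊤ = ≤-antisym (⊤-max _)

  ∃-unit : ∀ {A B} (f : Hom A B) (α : P A) → α ≤ (f *) (∃ f α)
  ∃-unit f α = proj₁ (∃⊣* f α _) (≤-refl _)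

  ∃-transpose : ∀ {A B} (f : Hom A B) {α : P A} {β : P B} → α ≤ (f *) β → ∃ f α ≤ β
  ∃-transpose f = proj₂ (∃⊣* f _ _)

  ∃-id : ∀ {A} (α : P A) → ∃ id α ≡ α
  ∃-id α = ≤-antisym (∃-transpose id (≤-reflexive (sym (*-id α))))
                     (subst (α ≤_) (*-id _) (∃-unit id α))

  ∃-∘ : ∀ {A B B'} (f : Hom A B) (g : Hom B B') (α : P A) → ∃ (g ∘ f) α ≡ ∃ g (∃ f α)
  ∃-∘ f g α = ≤-antisym
    (∃-transpose (g ∘ f) (≤-trans (∃-unit f α)
      (≤-trans (*-mono f (∃-unit g (∃ f α))) (≤-reflexive (sym (*-∘ f g _))))))
    (∃-transpose g (∃-transpose f (≤-trans (∃-unit (g ∘ f) α) (≤-reflexive (*-∘ f g _)))))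

  δ-≤-×ₘ* : ∀ {A B} (f : Hom A B) → δ A ≤ ((f ×ₘ f) *) (δ B)
  δ-≤-×ₘ* {A} {B} f = ∃-transpose Δ
    (subst (⊤ A ≤_) (sym Δ*f×f*δ≡f*Δ*δ)
      (subst (_≤ (f *) ((Δ *) (δ B))) (*-⊤ f) (*-mono f (∃-unit Δ (⊤ B)))))
    where
      Δ*f×f*δ≡f*Δ*δ : (Δ *) (((f ×ₘ f) *) (δ B)) ≡ (f *) ((Δ *) (δ B))
      Δ*f×f*δ≡f*Δ*δ = begin
        (Δ *) (((f ×ₘ f) *) (δ B))  ≡⟨ sym (*-∘ Δ (f ×ₘ f) _) ⟩
        (((f ×ₘ f) ∘ Δ) *) (δ B)    ≡⟨ cong (λ k → (k *) (δ B)) (×ₘ-Δ f) ⟩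
        ((Δ ∘ f) *) (δ B)           ≡⟨ *-∘ f Δ _ ⟩
        (f *) ((Δ *) (δ B))         ∎

  InternallyInjective-cancelˡ : ∀ {A B B'} (g : Hom B B') (f : Hom A B) →
                                InternallyInjective (g ∘ f) → InternallyInjective f
  InternallyInjective-cancelˡ {B' = B'} g f g∘f-inj =
    ≤-antisym (δ-≤-×ₘ* f) (subst (((f ×ₘ f) *) (δ _) ≤_) (sym δ≡f×f*g×g*δ)
                            (*-mono (f ×ₘ f) (δ-≤-×ₘ* g)))
    where
      δ≡f×f*g×g*δ : δ _ ≡ ((f ×ₘ f) *) (((g ×ₘ g) *) (δ B'))
      δ≡f×f*g×g*δ = begin
        δ _                                   ≡⟨ g∘f-inj ⟩
        (((g ∘ f) ×ₘ (g ∘ f)) *) (δ B')       ≡⟨ cong (λ k → (k *) (δ B')) (sym (×ₘ-∘ g f)) ⟩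
        (((g ×ₘ g) ∘ (f ×ₘ f)) *) (δ B')      ≡⟨ *-∘ _ _ _ ⟩
        ((f ×ₘ f) *) (((g ×ₘ g) *) (δ B'))    ∎

  module _ {A : Obj} {α : P A} (c : Comprehension α) where
    open Comprehension c

    ⌊⌋∘-sat : ∀ {Y} (u : Hom Y dom) → ⊤ Y ≤ ((⌊_⌋ ∘ u) *) α
    ⌊⌋∘-sat u = subst (⊤ _ ≤_) (sym (*-∘ u ⌊_⌋ α))
                  (subst (_≤ (u *) ((⌊_⌋ *) α)) (*-⊤ u) (*-mono u ⌊⌋-sat))

    ⌊⌋-monic : ∀ {Y} (u v : Hom Y dom) → ⌊_⌋ ∘ u ≡ ⌊_⌋ ∘ v → u ≡ v
    ⌊⌋-monic u v ⌊⌋u≡⌊⌋v with factor (⌊_⌋ ∘ u) (⌊⌋∘-sat u)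
    ... | _ , _ , unique = trans (unique u refl) (sym (unique v ⌊⌋u≡⌊⌋v))

    ⌊⌋-kernel-pullback : IsPullback C id id ⌊_⌋ ⌊_⌋
    ⌊⌋-kernel-pullback = refl , λ u v ⌊⌋u≡⌊⌋v →
      u , ((identityˡ u , trans (identityˡ u) (⌊⌋-monic u v ⌊⌋u≡⌊⌋v)) ,
           λ k id∘k≡u _ → trans (sym (identityˡ k)) id∘k≡u)

    ⌊⌋*-∃⌊⌋ : ∀ β → (⌊_⌋ *) (∃ ⌊_⌋ β) ≡ β
    ⌊⌋*-∃⌊⌋ β = begin
      (⌊_⌋ *) (∃ ⌊_⌋ β)   ≡⟨ sym (beck-chevalley id id ⌊_⌋ ⌊_⌋ ⌊⌋-kernel-pullback β) ⟩
      ∃ id ((id *) β)     ≡⟨ ∃-id _ ⟩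
      (id *) β            ≡⟨ *-id β ⟩
      β                   ∎

  image-factorisation : ∀ {X Y} (f : Hom X Y) (c : HasImage f) →
    Σ[ η ∈ Hom X (Comprehension.dom c) ] (f ≡ Comprehension.⌊_⌋ c ∘ η × InternallySurjective η)
  image-factorisation {X} f c with Comprehension.factor c f (∃-unit f (⊤ X))
  ... | η , f≡⌊⌋∘η , _ = η , f≡⌊⌋∘η , η-surjective
    where
      open Comprehension c

      η-surjective : InternallySurjective η
      η-surjective = begin
        ∃ η (⊤ X)                        ≡⟨ sym (⌊⌋*-∃⌊⌋ c _) ⟩
        (⌊_⌋ *) (∃ ⌊_⌋ (∃ η (⊤ X)))      ≡⟨ cong (⌊_⌋ *) (sym (∃-∘ η ⌊_⌋ _)) ⟩
        (⌊_⌋ *) (∃ (⌊_⌋ ∘ η) (⊤ X))      ≡⟨ cong (λ k → (⌊_⌋ *) (∃ k (⊤ X))) (sym f≡⌊⌋∘η) ⟩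
        (⌊_⌋ *) (∃ f (⊤ X))              ≡⟨ ⊤≤⇒≡⊤ ⌊⌋-sat ⟩
        ⊤ dom                            ∎

  InternallyInjective⇒image-bijective : ∀ {X Y} (f : Hom X Y) → InternallyInjective f →
    (c : HasImage f) → Σ[ η ∈ Hom X (Comprehension.dom c) ] InternallyBijective η
  InternallyInjective⇒image-bijective f f-injective c with image-factorisation f c
  ... | η , f≡⌊⌋∘η , η-surjective = η , η-injective , η-surjective
    where
      η-injective : InternallyInjective η
      η-injective = InternallyInjective-cancelˡ (Comprehension.⌊_⌋ c) η
                      (subst InternallyInjective f≡⌊⌋∘η f-injective)

lemma4p3 : ∀ {o h p} (C : Category o h) (Pr : FinProducts C) (D : Doctrine C Pr p)
           (E : Existential D) (S : Theory.Singletons E) (A : Category.Obj C)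
           (c : Theory.Comprehension E (Theory.PowerObjects.σ (Theory.Singletons.powers S) A)) →
           Σ[ η ∈ Category.Hom C A (Theory.Comprehension.dom c) ] Theory.InternallyBijective E η
lemma4p3 C Pr D E S A c =
  ElementaryExistential.InternallyInjective⇒image-bijective E (sing A) (sing-injective A) c
  where
    open Theory.Singletons S
    open Theory.PowerObjects powers
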